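{- Let $G$ be a complete $(m,n)$-mixed graph (i.e. $U(G)=K_{|V(G)|}$) with $\chi_s(G)>2$, and let $u,v\in V(G)$. Then $\mathrm{conv}(\{u,v\})\neq V(G)$ if and only if $c(u)=c(v)$ for every minimum simple colouring $c$ of $G$.
   Context: An $(m,n)$-mixed graph $G=(V,A,E)$ is a simple graph (no loops, at most one adjacency between any pair of vertices) in which each adjacency is either an arc or an edge, with colour functions $c_A: A \to \{1,\dots,m\}$, $c_E: E \to \{1,\dots,n\}$; $U(G)$ is its underlying simple graph. A simple homomorphism $\phi: G\to_s H$ is a map $V(G)\to V(H)$ such that either $|V(G)|=1$, or $\phi$ is non-constant and every adjacency $uv$ with $\phi(u)\neq\phi(v)$ is mapped to an adjacency of the same type (edge/arc, same direction, same colour); $\chi_s(G)$ is the least number of vertices of an $H$ with $G\to_s H$, and a minimum simple colouring is a simple homomorphism to an $(m,n)$-mixed graph on $\chi_s(G)$ vertices. If $xz, yz$ are adjacencies of $G$, then $x$ and $y$ agree on $z$ if $xz, yz$ are both edges of the same colour, or both arcs towards $z$ of the same colour, or both arcs from $z$ of the same colour; otherwise $z$ is between $x$ and $y$. A set $C\subseteq V(G)$ is convex if for all $x,y\in C$ no $z\in V(G)\setminus C$ is between $x$ and $y$; $\mathrm{conv}(N)$ is the smallest convex set containing $N$. -}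

module Defs where

open import Data.Nat using (ℕ; _≤_; _<_)
open import Data.Fin using (Fin)
open import Data.Fin.Subset using (Subset; _∈_; _∉_; _⊆_; ⁅_⁆; _∪_; ⊤)
open import Data.Product using (Σ; ∃; _×_; _,_)
open import Data.Sum using (_⊎_)
open import Relation.Nullary using (¬_)
open import Relation.Binary.PropositionalEquality using (_≡_; _≢_)

-- How a vertex x sees its relation to a vertex y in an (m,n)-mixed graph.
data Link (m n : ℕ) : Set where
  none : Link m n
  edge : Fin n → Link m n
  out  : Fin m → Link m n      -- an arc x → y of the given colour
  inn  : Fin m → Link m n      -- an arc y → x of the given colour

flipL : ∀ {m n} → Link m n → Link m n
flipL none     = none
flipL (edge c) = edge c
flipL (out c)  = inn c
flipL (inn c)  = out c

-- Simplicity: no loops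
-- and at most one adjacency per pair (the adjacency relation is a function
-- of the unordered pair, consistent under swapping).
record MixedGraph (m n : ℕ) : Set where
  field
    size  : ℕ
    rel   : Fin size → Fin size → Link m n
    loopless : ∀ x → rel x x ≡ none
    sym   : ∀ x y → rel y x ≡ flipL (rel x y)
open MixedGraph public

Adjacent : ∀ {m n} (G : MixedGraph m n) → Fin (size G) → Fin (size G) → Set
Adjacent G x y = rel G x y ≢ none

Complete : ∀ {m n} → MixedGraph m n → Set
Complete G = ∀ x y → x ≢ y → Adjacent G x y

IsSimpleHom : ∀ {m n} (G H : MixedGraph m n) → (Fin (size G) → Fin (size H)) → Set
IsSimpleHom G H φ =
  size G ≡ 1 ⊎
  ((∃ λ u → ∃ λ v → φ u ≢ φ v) ×
   (∀ u v → Adjacent G u v → φ u ≢ φ v → rel H (φ u) (φ v) ≡ rel G u v))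

IsChiS : ∀ {m n} → MixedGraph m n → ℕ → Set
IsChiS {m} {n} G k =
  (Σ (MixedGraph m n) λ H → size H ≡ k × Σ (Fin (size G) → Fin (size H)) (IsSimpleHom G H)) ×
  (∀ (H : MixedGraph m n) (φ : Fin (size G) → Fin (size H)) → IsSimpleHom G H φ → k ≤ size H)

IsMinSimpleColouring : ∀ {m n} (G : MixedGraph m n) (k : ℕ) (H : MixedGraph m n)
  → (Fin (size G) → Fin (size H)) → Set
IsMinSimpleColouring G k H c = size H ≡ k × IsSimpleHom G H c

Between : ∀ {m n} (G : MixedGraph m n) → (x y z : Fin (size G)) → Set
Between G x y z = Adjacent G x z × Adjacent G y z × rel G x z ≢ rel G y z

Convex : ∀ {m n} (G : MixedGraph m n) → Subset (size G) → Set
Convex G C = ∀ x y z → x ∈ C → y ∈ C → z ∉ C → ¬ Between G x y z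

IsConv : ∀ {m n} (G : MixedGraph m n) → Subset (size G) → Subset (size G) → Set
IsConv G N C = N ⊆ C × Convex G C × (∀ D → N ⊆ D → Convex G D → C ⊆ D)

pair : ∀ {k} → Fin k → Fin k → Subset k
pair u v = ⁅ u ⁆ ∪ ⁅ v ⁆

-- On a complete graph, a simple homomorphism is a colouring c such that the link
-- between two differently coloured vertices depends only on their colours
-- ("compatible"); conversely a non-constant compatible colouring with K colours is
-- a simple homomorphism onto a K-vertex quotient, so it bounds χ_s from above.
--
-- If every minimum colouring identifies u and v, the colour class of u is convex
-- and contains u and v, hence conv{u,v}; it is not everything since χ_s > 1 forces
-- a minimum colouring to be non-constant. Conversely, let x ∉ conv{u,v} = C and
-- let a minimum colouring c separate u and v. Vertices of C see each vertex outside
-- C alike. If every colour class meets C, the class of x sees all other classes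
-- alike, and "class of x or not" is a compatible 2-colouring. Otherwise merging all
-- classes meeting C into the class of u frees the colour of v. Both contradict
-- χ_s > 2.

module Submission where

open import Defs
open import Data.Nat using (ℕ; _<_; _≤_; suc; s≤s)
open import Data.Nat.Properties using (≤-trans; ≤-reflexive; <⇒≤; <⇒≱; <-irrefl)
open import Data.Fin using (Fin; zero; suc; punchOut)
open import Data.Fin.Properties using (_≟_; any?; all?; ¬∀⟶∃¬; punchOut-injective; punchOut-cong)
open import Data.Fin.Subset using (Subset; ⊤; _∈_; _∉_; _⊆_; ⁅_⁆; _∪_)
open import Data.Fin.Subset.Properties using (∈⊤; ⊆⊤; ⊆-antisym; _∈?_; x∈⁅x⁆; x∈⁅y⁆⇒x≡y; x∈p∪q⁻; x∈p∪q⁺)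
open import Data.Vec using (tabulate)
open import Data.Vec.Properties using (lookup∘tabulate; []=⇒lookup; lookup⇒[]=)
open import Data.Product using (∃; ∃₂; _×_; _,_; proj₁)
open import Data.Empty using (⊥)
open import Data.Sum using (_⊎_; inj₁; inj₂; [_,_])
open import Function using (id; _∘_)
open import Function.Bundles using (_⇔_; mk⇔)
open import Relation.Nullary using (¬_; Dec; yes; no; does; contradiction)
open import Relation.Nullary.Decidable using (_×-dec_; map′; decidable-stable; dec-true)
open import Relation.Unary using (Decidable)
open import Relation.Binary.Definitions using (DecidableEquality)
open import Relation.Binary.PropositionalEquality as ≡ using (_≡_; _≢_; refl; cong; cong₂; subst)
open ≡.≡-Reasoning

_≟L_ : ∀ {m n} → DecidableEquality (Link m n)
none   ≟L none   = yes refl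
edge c ≟L edge d = map′ (cong edge) (λ { refl → refl }) (c ≟ d)
out c  ≟L out d  = map′ (cong out) (λ { refl → refl }) (c ≟ d)
inn c  ≟L inn d  = map′ (cong inn) (λ { refl → refl }) (c ≟ d)
none   ≟L edge _ = no λ ()
none   ≟L out _  = no λ ()
none   ≟L inn _  = no λ ()
edge _ ≟L none   = no λ ()
edge _ ≟L out _  = no λ ()
edge _ ≟L inn _  = no λ ()
out _  ≟L none   = no λ ()
out _  ≟L edge _ = no λ ()
out _  ≟L inn _  = no λ ()
inn _  ≟L none   = no λ ()
inn _  ≟L edge _ = no λ ()
inn _  ≟L out _  = no λ ()

Fin1-unique : ∀ {N} → N ≡ 1 → (a b : Fin N) → a ≡ b
Fin1-unique refl zero zero = refl

decToFin2 : {P : Set} → Dec P → Fin 2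
decToFin2 (yes _) = zero
decToFin2 (no _)  = suc zero

fibre : ∀ {N K} → (Fin N → Fin K) → Fin K → Subset N
fibre c i = tabulate (λ y → does (c y ≟ i))

module _ {N K} (c : Fin N → Fin K) {i : Fin K} where

  ∈-fibre⁺ : ∀ {y} → c y ≡ i → y ∈ fibre c i
  ∈-fibre⁺ {y} cy≡i = lookup⇒[]= y _ (≡.trans (lookup∘tabulate _ y) (dec-true (c y ≟ i) cy≡i))

  ∈-fibre⁻ : ∀ {y} → y ∈ fibre c i → c y ≡ i
  ∈-fibre⁻ {y} y∈ with c y ≟ i | ≡.trans (≡.sym (lookup∘tabulate _ y)) ([]=⇒lookup y∈)
  ... | yes cy≡i | _ = cy≡i
  ... | no _     | ()

pair⊆ : ∀ {N} {u v : Fin N} {D : Subset N} → u ∈ D → v ∈ D → pair u v ⊆ D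
pair⊆ {u = u} {v} {D} u∈D v∈D y∈ = [ at u u∈D , at v v∈D ] (x∈p∪q⁻ ⁅ u ⁆ ⁅ v ⁆ y∈)
  where
  at : ∀ {y} x → x ∈ D → y ∈ ⁅ x ⁆ → y ∈ D
  at x x∈D y∈⁅x⁆ = subst (_∈ D) (≡.sym (x∈⁅y⁆⇒x≡y x y∈⁅x⁆)) x∈D

merge : ∀ {K} {P : Fin K → Set} → Decidable P → Fin K → Fin K → Fin K
merge P? s j with P? j
... | yes _ = s
... | no _  = j

module _ {K} {P : Fin K → Set} (P? : Decidable P) {s : Fin K} where

  merge-in : ∀ {j} → P j → merge P? s j ≡ s
  merge-in {j} p with P? j
  ... | yes _ = refl
  ... | no ¬p = contradiction p ¬p

  merge-out : ∀ {j} → ¬ P j → merge P? s j ≡ j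
  merge-out {j} ¬p with P? j
  ... | yes p = contradiction p ¬p
  ... | no _  = refl

  merge-reflects : P s → ∀ {j j'} → merge P? s j ≡ merge P? s j' → P j → P j'
  merge-reflects Ps {j} {j'} e p with P? j'
  ... | yes p' = p'
  ... | no ¬p' = contradiction (subst P (≡.trans (≡.sym (merge-in p)) e) Ps) ¬p'

  merge-out-injective : P s → ∀ {j j'} → ¬ P j → merge P? s j ≡ merge P? s j' → j ≡ j'
  merge-out-injective Ps {j} {j'} ¬p e = begin
    j                ≡⟨ merge-out ¬p ⟨
    merge P? s j     ≡⟨ e ⟩
    merge P? s j'    ≡⟨ merge-out (¬p ∘ merge-reflects Ps (≡.sym e)) ⟩
    j'               ∎

module _ {m n} (G : MixedGraph m n) where

  private
    V : Set
    V = Fin (size G)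

  Compatible : {A : Set} → (V → A) → Set
  Compatible φ = ∀ a a' b b' → φ a ≡ φ a' → φ b ≡ φ b' → φ a ≢ φ b → rel G a b ≡ rel G a' b'

  Nonconstant : {A : Set} → (V → A) → Set
  Nonconstant φ = ∃₂ λ a b → φ a ≢ φ b

  rel-swap : ∀ {a b a' b'} → rel G b a ≡ rel G b' a' → rel G a b ≡ rel G a' b'
  rel-swap {a} {b} {a'} {b'} e = begin
    rel G a b            ≡⟨ sym G b a ⟩
    flipL (rel G b a)    ≡⟨ cong flipL e ⟩
    flipL (rel G b' a')  ≡⟨ sym G b' a' ⟨
    rel G a' b'          ∎

  compatible-kernel : {A B : Set} {φ : V → A} {ψ : V → B}
    → (∀ a b → φ a ≡ φ b → ψ a ≡ ψ b) → (∀ a b → ψ a ≡ ψ b → φ a ≡ φ b)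
    → Compatible φ → Compatible ψ
  compatible-kernel φ⇒ψ ψ⇒φ compat a a' b b' ea eb ne =
    compat a a' b b' (ψ⇒φ a a' ea) (ψ⇒φ b b' eb) (ne ∘ φ⇒ψ a b)

  simpleHom-compatible : Complete G → ∀ {H} {c : V → Fin (size H)} → IsSimpleHom G H c → Compatible c
  simpleHom-compatible _ {c = c} (inj₁ size≡1) a a' b b' _ _ ne =
    contradiction (cong c (Fin1-unique size≡1 a b)) ne
  simpleHom-compatible complete {H} {c} (inj₂ (_ , preserves)) a a' b b' ea eb ne = begin
    rel G a b            ≡⟨ preserves a b (complete a b (ne ∘ cong c)) ne ⟨
    rel H (c a) (c b)    ≡⟨ cong₂ (rel H) ea eb ⟩
    rel H (c a') (c b')  ≡⟨ preserves a' b' (complete a' b' (ne' ∘ cong c)) ne' ⟩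
    rel G a' b'          ∎
    where
    ne' : c a' ≢ c b'
    ne' e = ne (≡.trans ea (≡.trans e (≡.sym eb)))

  -- Unused colours are isolated; used ones are joined as any of their members are.
  module Quotient {K} (φ : V → Fin K) where

    private
      Used : Fin K → Set
      Used i = ∃ λ a → φ a ≡ i

      link : ∀ {i j} → Dec (Used i) → Dec (Used j) → Link m n
      link (yes (a , _)) (yes (b , _)) = rel G a b
      link _             _             = none

      link-loopless : ∀ {i} (p : Dec (Used i)) → link p p ≡ none
      link-loopless (yes (a , _)) = loopless G a
      link-loopless (no _)        = refl

      link-sym : ∀ {i j} (p : Dec (Used i)) (q : Dec (Used j)) → link q p ≡ flipL (link p q)
      link-sym (yes (a , _)) (yes (b , _)) = sym G a b
      link-sym (yes _)       (no _)        = refl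
      link-sym (no _)        (yes _)       = refl
      link-sym (no _)        (no _)        = refl

      used? : (i : Fin K) → Dec (Used i)
      used? i = any? (λ a → φ a ≟ i)

    quotient : MixedGraph m n
    quotient = record
      { size     = K
      ; rel      = λ i j → link (used? i) (used? j)
      ; loopless = λ i → link-loopless (used? i)
      ; sym      = λ i j → link-sym (used? i) (used? j)
      }

    quotient-simpleHom : Compatible φ → Nonconstant φ → IsSimpleHom G quotient φ
    quotient-simpleHom compat nonconstant =
      inj₂ (nonconstant , λ x y _ ne → preserves x y ne (used? (φ x)) (used? (φ y)))
      where
      preserves : ∀ x y → φ x ≢ φ y → (p : Dec (Used (φ x))) (q : Dec (Used (φ y)))
        → link p q ≡ rel G x y
      preserves x y ne (yes (a , φa≡φx)) (yes (b , φb≡φy)) =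
        compat a x b y φa≡φx φb≡φy (λ e → ne (≡.trans (≡.sym φa≡φx) (≡.trans e φb≡φy)))
      preserves x y _ (no unused) _       = contradiction (x , refl) unused
      preserves x y _ (yes _) (no unused) = contradiction (y , refl) unused

  open Quotient using (quotient; quotient-simpleHom) public

  χ-lowerBound : ∀ {k K} → IsChiS G k → (φ : V → Fin K) → Compatible φ → Nonconstant φ → k ≤ K
  χ-lowerBound (_ , minimal) φ compat nonconstant =
    minimal (quotient φ) φ (quotient-simpleHom φ compat nonconstant)

  χ<-missingColour : ∀ {k K} → IsChiS G k → (φ : V → Fin K) → Compatible φ → Nonconstant φ
    → (j : Fin K) → (∀ w → j ≢ φ w) → k < K
  χ<-missingColour {K = suc K} χ φ compat (a , b , φa≢φb) j missing =
    s≤s (χ-lowerBound χ φ' (compatible-kernel (λ _ _ → punchOut-cong j) φ'-reflects compat)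
                         (a , b , φa≢φb ∘ φ'-reflects a b))
    where
    φ' : V → Fin K
    φ' w = punchOut (missing w)
    φ'-reflects : ∀ a b → φ' a ≡ φ' b → φ a ≡ φ b
    φ'-reflects a b = punchOut-injective (missing a) (missing b)

  minColouring-nonconstant : ∀ {k H} {c : V → Fin (size H)} → IsChiS G k → 1 < k
    → IsSimpleHom G H c → Nonconstant c
  minColouring-nonconstant (_ , minimal) 1<k (inj₁ size≡1) =
    contradiction (≤-trans (minimal G id (inj₁ size≡1)) (≤-reflexive size≡1)) (<⇒≱ 1<k)
  minColouring-nonconstant _ _ (inj₂ (nonconstant , _)) = nonconstant

  fibre-convex : ∀ {K} {c : V → Fin K} → Compatible c → ∀ i → Convex G (fibre c i)
  fibre-convex {c = c} compat i x y z x∈ y∈ z∉ (_ , _ , links≢) =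
    links≢ (compat x y z z (≡.trans (∈-fibre⁻ c x∈) (≡.sym (∈-fibre⁻ c y∈))) refl
                            (λ cx≡cz → z∉ (∈-fibre⁺ c (≡.trans (≡.sym cx≡cz) (∈-fibre⁻ c x∈)))))

  convex-sameLink : Complete G → ∀ {C} → Convex G C
    → ∀ {p q z} → p ∈ C → q ∈ C → z ∉ C → rel G p z ≡ rel G q z
  convex-sameLink complete {C} convex {p} {q} {z} p∈ q∈ z∉ =
    decidable-stable (rel G p z ≟L rel G q z)
      λ links≢ → convex p q z p∈ q∈ z∉ (complete p z (distinct p∈) , complete q z (distinct q∈) , links≢)
    where
    distinct : ∀ {x} → x ∈ C → x ≢ z
    distinct x∈ x≡z = z∉ (subst (_∈ C) x≡z x∈)

  indicator-compatible : {Q : V → Set} (Q? : Decidable Q) (r : Link m n)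
    → (∀ a b → Q a → ¬ Q b → rel G a b ≡ r) → Compatible (λ y → decToFin2 (Q? y))
  indicator-compatible Q? r across a a' b b' ea eb ne with Q? a | Q? a' | Q? b | Q? b'
  ... | yes qa | yes qa' | no ¬qb | no ¬qb' =
    ≡.trans (across a b qa ¬qb) (≡.sym (across a' b' qa' ¬qb'))
  ... | no ¬qa | no ¬qa' | yes qb | yes qb' =
    rel-swap (≡.trans (across b a qb ¬qa) (≡.sym (across b' a' qb' ¬qa')))
  ... | yes _  | _      | yes _  | _       = contradiction refl ne
  ... | no _   | _      | no _   | _       = contradiction refl ne
  ... | yes _  | no _   | _      | _       = contradiction ea λ ()
  ... | no _   | yes _  | _      | _       = contradiction ea λ ()
  ... | _      | _      | yes _  | no _    = contradiction eb λ ()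
  ... | _      | _      | no _   | yes _   = contradiction eb λ ()

  indicator-nonconstant : {Q : V → Set} (Q? : Decidable Q) → ∀ {a b} → Q a → ¬ Q b
    → Nonconstant (λ y → decToFin2 (Q? y))
  indicator-nonconstant {Q} Q? {a} {b} qa ¬qb = a , b , distinct (Q? a) (Q? b)
    where
    distinct : (p : Dec (Q a)) (q : Dec (Q b)) → decToFin2 p ≢ decToFin2 q
    distinct (yes _)  (no _)   ()
    distinct (no ¬qa) _        = contradiction qa ¬qa
    distinct _        (yes qb) = contradiction qb ¬qb

  merge-compatible : ∀ {K} {c : V → Fin K} {P : Fin K → Set} (P? : Decidable P) {s}
    → P s → Compatible c
    → (∀ a a' b → P (c a) → P (c a') → ¬ P (c b) → rel G a b ≡ rel G a' b)
    → Compatible (merge P? s ∘ c)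
  merge-compatible {c = c} {P} P? {s} Ps compat across a a' b b' ea eb ne = cases (P? (c a)) (P? (c b))
    where
    mixed : ∀ a a' b b' → merge P? s (c a) ≡ merge P? s (c a')
      → merge P? s (c b) ≡ merge P? s (c b') → P (c a) → ¬ P (c b) → rel G a b ≡ rel G a' b'
    mixed a a' b b' ea eb pa ¬pb = begin
      rel G a b    ≡⟨ across a a' b pa pa' ¬pb ⟩
      rel G a' b   ≡⟨ compat a' a' b b' refl (merge-out-injective P? Ps ¬pb eb)
                                             (λ e → ¬pb (subst P e pa')) ⟩
      rel G a' b'  ∎
      where
      pa' : P (c a')
      pa' = merge-reflects P? Ps ea pa

    cases : Dec (P (c a)) → Dec (P (c b)) → rel G a b ≡ rel G a' b'
    cases (yes pa) (yes pb) = contradiction (≡.trans (merge-in P? pa) (≡.sym (merge-in P? pb))) ne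
    cases (yes pa) (no ¬pb) = mixed a a' b b' ea eb pa ¬pb
    cases (no ¬pa) (yes pb) = rel-swap (mixed b b' a a' eb ea pb ¬pa)
    cases (no ¬pa) (no ¬pb) =
      compat a a' b b' (merge-out-injective P? Ps ¬pa ea) (merge-out-injective P? Ps ¬pb eb)
                       (ne ∘ cong (merge P? s))

module _ {m n} (G : MixedGraph m n) (complete : Complete G) {C : Subset (size G)} (convex : Convex G C)
         {K} {c : Fin (size G) → Fin K} (compat : Compatible G c) where

  private
    V : Set
    V = Fin (size G)

  Meets : Fin K → Set
  Meets j = ∃ λ w → c w ≡ j × w ∈ C

  meets? : Decidable Meets
  meets? j = any? (λ w → (c w ≟ j) ×-dec (w ∈? C))

  link-from-class : (∀ y → Meets (c y)) → ∀ {u x a b} → u ∈ C → x ∉ C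
    → c a ≡ c x → c b ≢ c x → rel G a b ≡ flipL (rel G u x)
  link-from-class allMeet {u} {x} {a} {b} u∈ x∉ ca≡cx cb≢cx with allMeet b
  ... | w , cw≡cb , w∈ = begin
    rel G a b          ≡⟨ compat a x b b ca≡cx refl (λ e → cb≢cx (≡.trans (≡.sym e) ca≡cx)) ⟩
    rel G x b          ≡⟨ compat x x b w refl (≡.sym cw≡cb) (cb≢cx ∘ ≡.sym) ⟩
    rel G x w          ≡⟨ sym G w x ⟩
    flipL (rel G w x)  ≡⟨ cong flipL (convex-sameLink G complete convex w∈ u∈ x∉) ⟩
    flipL (rel G u x)  ∎

  link-to-unmet : ∀ {u a b} → u ∈ C → Meets (c a) → ¬ Meets (c b) → rel G a b ≡ rel G u b
  link-to-unmet {u} {a} {b} u∈ (p , cp≡ca , p∈) ¬mb = begin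
    rel G a b  ≡⟨ compat a p b b (≡.sym cp≡ca) refl (λ e → ¬mb (p , ≡.trans cp≡ca e , p∈)) ⟩
    rel G p b  ≡⟨ convex-sameLink G complete convex p∈ u∈ (λ b∈ → ¬mb (b , refl , b∈)) ⟩
    rel G u b  ∎

  χ≤2-ifAllMeet : ∀ {k u v x} → IsChiS G k → (∀ y → Meets (c y))
    → u ∈ C → v ∈ C → x ∉ C → c u ≢ c v → k ≤ 2
  χ≤2-ifAllMeet {u = u} {v} {x} χ allMeet u∈ v∈ x∉ cu≢cv =
    χ-lowerBound G χ _ (indicator-compatible G sameAsX _ (λ _ _ → link-from-class allMeet u∈ x∉))
                       nonconstant
    where
    sameAsX : Decidable (λ y → c y ≡ c x)
    sameAsX y = c y ≟ c x
    nonconstant : Nonconstant G (λ y → decToFin2 (sameAsX y))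
    nonconstant with c u ≟ c x
    ... | no cu≢cx  = indicator-nonconstant G sameAsX refl cu≢cx
    ... | yes cu≡cx =
      indicator-nonconstant G sameAsX refl (λ cv≡cx → cu≢cv (≡.trans cu≡cx (≡.sym cv≡cx)))

  χ<-ifSomeUnmet : ∀ {k u v y} → IsChiS G k → u ∈ C → v ∈ C → c u ≢ c v → ¬ Meets (c y) → k < K
  χ<-ifSomeUnmet {u = u} {v} {y} χ u∈ v∈ cu≢cv ¬my =
    χ<-missingColour G χ ψ (merge-compatible G meets? mu compat across) (u , y , ψu≢ψy) (c v) missing
    where
    mu : Meets (c u)
    mu = u , refl , u∈
    ψ : V → Fin K
    ψ = merge meets? (c u) ∘ c
    across : ∀ a a' b → Meets (c a) → Meets (c a') → ¬ Meets (c b) → rel G a b ≡ rel G a' b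
    across a a' b ma ma' ¬mb = ≡.trans (link-to-unmet u∈ ma ¬mb) (≡.sym (link-to-unmet u∈ ma' ¬mb))
    ψu≢ψy : ψ u ≢ ψ y
    ψu≢ψy e =
      ¬my (subst Meets (≡.trans (≡.sym (merge-in meets? mu)) (≡.trans e (merge-out meets? ¬my))) mu)
    missing : ∀ w → c v ≢ ψ w
    missing w = byMeeting (meets? (c w))
      where
      byMeeting : Dec (Meets (c w)) → c v ≢ ψ w
      byMeeting (yes mw) cv≡ψw = cu≢cv (≡.sym (≡.trans cv≡ψw (merge-in meets? mw)))
      byMeeting (no ¬mw) cv≡ψw = ¬mw (v , ≡.trans cv≡ψw (merge-out meets? ¬mw) , v∈)

  χ≤2⊎χ< : ∀ {k u v x} → IsChiS G k → u ∈ C → v ∈ C → x ∉ C → c u ≢ c v → k ≤ 2 ⊎ k < K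
  χ≤2⊎χ< χ u∈ v∈ x∉ cu≢cv with all? (λ y → meets? (c y))
  ... | yes allMeet = inj₁ (χ≤2-ifAllMeet χ allMeet u∈ v∈ x∉ cu≢cv)
  ... | no someUnmet with ¬∀⟶∃¬ _ _ (λ y → meets? (c y)) someUnmet
  ...   | _ , ¬my = inj₂ (χ<-ifSomeUnmet χ u∈ v∈ cu≢cv ¬my)

module _ {m n} (G : MixedGraph m n) (complete : Complete G) {k : ℕ} (χ : IsChiS G k)
         {u v : Fin (size G)} {C : Subset (size G)} where

  proper⇒sameColour : 2 < k → Convex G C → u ∈ C → v ∈ C → C ≢ ⊤
    → ∀ {H} {c : Fin (size G) → Fin (size H)} → IsMinSimpleColouring G k H c → c u ≡ c v
  proper⇒sameColour 2<k convex u∈ v∈ C≢⊤ {H} {c} (size≡k , hom) =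
    decidable-stable (c u ≟ c v) λ cu≢cv →
      C≢⊤ (⊆-antisym ⊆⊤ λ {x} _ → decidable-stable (x ∈? C) λ x∉ →
        tooFew (χ≤2⊎χ< G complete convex (simpleHom-compatible G complete {H} {c} hom)
                       χ u∈ v∈ x∉ cu≢cv))
    where
    tooFew : k ≤ 2 ⊎ k < size H → ⊥
    tooFew (inj₁ k≤2) = <⇒≱ 2<k k≤2
    tooFew (inj₂ k<K) = <-irrefl (≡.sym size≡k) k<K

  conv⊆fibre : ∀ {K} {c : Fin (size G) → Fin K} → Compatible G c → IsConv G (pair u v) C → c u ≡ c v
    → C ⊆ fibre c (c u)
  conv⊆fibre {c = c} compat (_ , _ , least) cu≡cv =
    least _ (pair⊆ (∈-fibre⁺ c refl) (∈-fibre⁺ c (≡.sym cu≡cv))) (fibre-convex G compat (c u))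

  sameColour⇒proper : 1 < k → IsConv G (pair u v) C
    → (∀ H (c : Fin (size G) → Fin (size H)) → IsMinSimpleColouring G k H c → c u ≡ c v) → C ≢ ⊤
  sameColour⇒proper 1<k conv sameColour C≡⊤ with proj₁ χ
  ... | H , size≡k , c , hom with minColouring-nonconstant G {H = H} {c} χ 1<k hom
  ...   | a , b , ca≢cb = ca≢cb (≡.trans (coloursAsU a) (≡.sym (coloursAsU b)))
    where
    coloursAsU : ∀ x → c x ≡ c u
    coloursAsU x = ∈-fibre⁻ c (conv⊆fibre (simpleHom-compatible G complete {H} {c} hom) conv
                                          (sameColour H c (size≡k , hom))
                                          (subst (x ∈_) (≡.sym C≡⊤) ∈⊤))

mainTheorem14 : ∀ {m n} (G : MixedGraph m n) → Complete G
    → (k : ℕ) → IsChiS G k → 2 < k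
    → (u v : Fin (size G)) (C : Subset (size G)) → IsConv G (pair u v) C
    → (C ≢ ⊤) ⇔ (∀ (H : MixedGraph m n) (c : Fin (size G) → Fin (size H))
    → IsMinSimpleColouring G k H c → c u ≡ c v)
mainTheorem14 G complete k χ 2<k u v C conv@(pair⊆C , convex , _) =
  mk⇔ (λ C≢⊤ H c → proper⇒sameColour G complete χ 2<k convex u∈C v∈C C≢⊤ {H} {c})
      (sameColour⇒proper G complete χ {u} {v} (<⇒≤ 2<k) conv)
  where
  u∈C : u ∈ C
  u∈C = pair⊆C (x∈p∪q⁺ (inj₁ (x∈⁅x⁆ u)))
  v∈C : v ∈ C
  v∈C = pair⊆C (x∈p∪q⁺ (inj₂ (x∈⁅x⁆ v)))
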